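{- Consider the Derandomized Random Greedy algorithm described in the context, run on a non-negative submodular $f$ on ground set $N$ (containing the set $D$ of dummy elements) and a matroid of rank $k$. For every element $u\in N\setminus D$ and every $0\le i\le k$, \[ \Pr_{S\sim\mathcal{D}_i}[u\notin S]\ \ge\ \frac12\left(1+\left(1-\frac2k\right)^i\right). \]
   Context: Notation: $f(u\mid S)=f(S\cup\{u\})-f(S)$, $S+u=S\cup\{u\}$, $S-u=S\setminus\{u\}$. Dummy elements: starting from an original instance $(N_0,f_0,\mathcal{M}_0)$ of rank $k$, one adds a set $D$ of $2k$ dummy elements and works with $N=N_0\cup D$, $f(S)=f_0(S\setminus D)$, and $\mathcal{I}=\{S\subseteq N: S\setminus D\in\mathcal{I}_0,\ |S|\le k\}$. Exchange property: for any two bases $A,B$ there is a one-to-one map $g:A\to B$ with $g(u)=u$ for $u\in A\cap B$ and $B\cup\{u\}\setminus\{g(u)\}\in\mathcal{I}$ for all $u\in A$. A distribution $\mathcal{D}$ is represented by a multiset of pairs $(p_j,S_j)$ with $p_j\ge0$; $\mathrm{supp}(\mathcal{D})$ is the set of distinct $S_j$ and $\Pr_{\mathcal{D}}[S]$ the total probability of pairs with set $S$. Algorithm: Let $\mathcal{D}_0=\{(1,S)\}$ where $S$ is a base consisting only of dummy elements. For $i=1,\dots,k$: (a) let $M_i$ be a base maximizing $\sum_{u\in M_i}\mathbb{E}_{S\sim\mathcal{D}_{i-1}}[f(u\mid S)]$; (b) for every $S\in\mathrm{supp}(\mathcal{D}_{i-1})$ let $g_{i,S}:M_i\to S$ be a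 map as in the exchange property with $A=M_i,B=S$; (c) find an extreme-point solution $x$ (variables $x(u,S)$, $u\in M_i$, $S\in\mathrm{supp}(\mathcal{D}_{i-1})$) of the system (P): $\sum_{u\in M_i}\mathbb{E}_{S\sim\mathcal{D}_{i-1}}[x(u,S) f(u\mid S)]\ge \frac1k\sum_{u\in M_i}\mathbb{E}_{S\sim\mathcal{D}_{i-1}}[f(u\mid S)]$; $\sum_{u\in M_i}\mathbb{E}_{S\sim\mathcal{D}_{i-1}}[x(u,S) f(g_{i,S}(u)\mid S\setminus\{g_{i,S}(u)\})]\le \frac1k\sum_{u\in M_i}\mathbb{E}_{S\sim\mathcal{D}_{i-1}}[f(g_{i,S}(u)\mid S\setminus\{g_{i,S}(u)\})]$; $\mathbb{E}_{S\sim\mathcal{D}_{i-1}}[x(u,S)\mathbf{1}[u\notin S]]\le \frac1k\Pr_{S\sim\mathcal{D}_{i-1}}[u\notin S]$ for all $u\in M_i$; $\mathbb{E}_{S\sim\mathcal{D}_{i-1}}[x(g_{i,S}^{ -1}(u),S)\mathbf{1}[u\in S]]\ge \frac1k\Pr_{S\sim\mathcal{D}_{i-1}}[u\in S]$ for all $u\in N$; $\sum_{u\in M_i}x(u,S)=1$ for all $S\in\mathrm{supp}(\mathcal{D}_{i-1})$; $x(u,S)\ge0$; (d) set $\mathcal{D}_i=\{(x(u,S)\Pr_{\mathcal{D}_{i-1}}[S],\ S+u-g_{i,S}(u)) : u\in M_i, S\in\mathrm{supp}(\mathcal{D}_{i-1}), x(u,S)>0\}$. Output $\arg\max_{S\i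n\mathrm{supp}(\mathcal{D}_k)}f(S)$.
   Formalization: The function f, the probabilities of the distributions $\mathcal{D}_i$ and the solutions x of the system (P) take values in ℚ rather than ℝ. -}

module Defs where

open import Data.Nat using (ℕ; zero; suc; NonZero; _<_) renaming (_≤_ to _≤ℕ_; _*_ to _*ℕ_)
open import Data.Fin using (Fin) renaming (_≟_ to _≟F_)
open import Data.Fin.Subset using (Subset; _∈_; _∉_; _⊆_; ⁅_⁆; _∪_; _∩_; _─_; ∣_∣; ∁) renaming (⊥ to ∅)
open import Data.Fin.Subset.Properties using (_∈?_)
open import Data.Bool.Properties using () renaming (_≟_ to _≟B_)
open import Data.Vec.Properties using (≡-dec)
open import Data.Integer using (+_)
open import Data.Rational using (ℚ; 0ℚ; 1ℚ; ½; _+_; _*_; _-_; _≤_; _/_)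
open import Data.Rational.Properties using (_<?_)
open import Data.List using (List; []; _∷_; [_]; map; foldr; filter; deduplicate; concatMap; allFin)
open import Data.List.Membership.Propositional using () renaming (_∈_ to _∈L_)
open import Data.Product using (_×_; _,_; proj₁; proj₂; Σ-syntax; ∃-syntax)
open import Relation.Nullary using (Dec; yes; no; ¬_; ¬?)
open import Relation.Binary.PropositionalEquality using (_≡_)

sumℚ : List ℚ → ℚ
sumℚ = foldr _+_ 0ℚ

Σ-over : {A : Set} → List A → (A → ℚ) → ℚ
Σ-over xs h = sumℚ (map h xs)

𝟙 : {P : Set} → Dec P → ℚ
𝟙 (yes _) = 1ℚ
𝟙 (no _)  = 0ℚ

_^ℚ_ : ℚ → ℕ → ℚ
q ^ℚ zero  = 1ℚ
q ^ℚ suc i = q * (q ^ℚ i)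

keepIf : {P : Set} {A : Set} → Dec P → A → List A
keepIf (yes _) a = [ a ]
keepIf (no _)  a = []

_≟S_ : {n : ℕ} → (S T : Subset n) → Dec (S ≡ T)
_≟S_ = ≡-dec _≟B_

elems : {n : ℕ} → Subset n → List (Fin n)
elems {n} S = filter (_∈? S) (allFin n)

_+ₑ_ : {n : ℕ} → Subset n → Fin n → Subset n
S +ₑ u = S ∪ ⁅ u ⁆

_-ₑ_ : {n : ℕ} → Subset n → Fin n → Subset n
S -ₑ u = S ─ ⁅ u ⁆

marg : {n : ℕ} → (Subset n → ℚ) → Fin n → Subset n → ℚ
marg f u S = f (S +ₑ u) - f S

record IsMatroidOn {n : ℕ} (N₀ : Subset n) (I : Subset n → Set) : Set where
  field
    ground      : ∀ A → I A → A ⊆ N₀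
    empty-indep : I ∅
    down-closed : ∀ A B → B ⊆ A → I A → I B
    augment     : ∀ A B → I A → I B → ∣ A ∣ < ∣ B ∣ →
                  ∃[ u ] (u ∈ B × u ∉ A × I (A +ₑ u))

HasRank : {n : ℕ} → (Subset n → Set) → ℕ → Set
HasRank I k = (∃[ A ] (I A × ∣ A ∣ ≡ k)) × (∀ A → I A → ∣ A ∣ ≤ℕ k)

-- An original instance (N₀ , f₀ , M₀) of rank k, where the ground set is
-- Fin n, D ⊆ Fin n is the set of 2k dummy elements and N₀ = ∁ D.
-- f₀ is only ever evaluated on subsets of N₀.

record OriginalInstance {n : ℕ} (k : ℕ) (D : Subset n)
                        (f₀ : Subset n → ℚ) (I₀ : Subset n → Set) : Set where
  field
    dummies-size : ∣ D ∣ ≡ 2 *ℕ k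
    nonneg       : ∀ S → S ⊆ ∁ D → 0ℚ ≤ f₀ S
    submodular   : ∀ S T → S ⊆ ∁ D → T ⊆ ∁ D →
                   f₀ (S ∪ T) + f₀ (S ∩ T) ≤ f₀ S + f₀ T
    matroid      : IsMatroidOn (∁ D) I₀
    rank         : HasRank I₀ k

-- Finite distributions: multisets of pairs (p , S)

Dist : ℕ → Set
Dist n = List (ℚ × Subset n)

supp : {n : ℕ} → Dist n → List (Subset n)
supp 𝒟 = deduplicate _≟S_ (map proj₂ 𝒟)

Pr : {n : ℕ} → Dist n → Subset n → ℚ
Pr 𝒟 S = sumℚ (map proj₁ (filter (λ p → proj₂ p ≟S S) 𝒟))

𝔼 : {n : ℕ} → Dist n → (Subset n → ℚ) → ℚ
𝔼 𝒟 h = Σ-over (supp 𝒟) (λ S → Pr 𝒟 S * h S)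

PrNotIn : {n : ℕ} → Dist n → Fin n → ℚ
PrNotIn 𝒟 u = 𝔼 𝒟 (λ S → 𝟙 (¬? (u ∈? S)))

PrIn : {n : ℕ} → Dist n → Fin n → ℚ
PrIn 𝒟 u = 𝔼 𝒟 (λ S → 𝟙 (u ∈? S))

module DRG {n : ℕ} (k : ℕ) {{_ : NonZero k}} (D : Subset n)
           (f₀ : Subset n → ℚ) (I₀ : Subset n → Set) where

  f : Subset n → ℚ
  f S = f₀ (S ─ D)

  Indep : Subset n → Set
  Indep S = I₀ (S ─ D) × ∣ S ∣ ≤ℕ k

  Base : Subset n → Set
  Base B = Indep B × (∀ u → u ∉ B → ¬ Indep (B +ₑ u))

  1/k : ℚ
  1/k = + 1 / k

  -- g : A → B as in the exchange property (g given as a function on Fin n,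
  -- only its values on A matter)
  ExchangeMap : Subset n → Subset n → (Fin n → Fin n) → Set
  ExchangeMap A B g =
      (∀ u → u ∈ A → g u ∈ B)
    × (∀ u v → u ∈ A → v ∈ A → g u ≡ g v → u ≡ v)
    × (∀ u → u ∈ A → u ∈ B → g u ≡ u)
    × (∀ u → u ∈ A → Indep ((B +ₑ u) -ₑ g u))

  score : Dist n → Subset n → ℚ
  score 𝒟 M = Σ-over (elems M) (λ u → 𝔼 𝒟 (λ S → marg f u S))

  lossTerm : (Subset n → Fin n → Fin n) → Fin n → Subset n → ℚ
  lossTerm g u S = marg f (g S u) (S -ₑ g S u)

  -- the system (P); the variables are x(u,S) for u ∈ M, S ∈ supp 𝒟
  -- (x is given as a total function, only those values matter)
  Feasible : Dist n → Subset n → (Subset n → Fin n → Fin n) →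
             (Fin n → Subset n → ℚ) → Set
  Feasible 𝒟 M g x =
      (1/k * Σ-over (elems M) (λ u → 𝔼 𝒟 (λ S → marg f u S))
         ≤ Σ-over (elems M) (λ u → 𝔼 𝒟 (λ S → x u S * marg f u S)))
    × (Σ-over (elems M) (λ u → 𝔼 𝒟 (λ S → x u S * lossTerm g u S))
         ≤ 1/k * Σ-over (elems M) (λ u → 𝔼 𝒟 (λ S → lossTerm g u S)))
    × (∀ u → u ∈ M →
         𝔼 𝒟 (λ S → x u S * 𝟙 (¬? (u ∈? S))) ≤ 1/k * PrNotIn 𝒟 u)
    -- x(g_S^{-1}(u), S) · 1[u ∈ S], written as Σ_{v ∈ M, g_S(v) = u} x(v,S) · 1[u ∈ S]
    × (∀ u → 1/k * PrIn 𝒟 u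
         ≤ 𝔼 𝒟 (λ S → Σ-over (elems M) (λ v → x v S * 𝟙 (g S v ≟F u)) * 𝟙 (u ∈? S)))
    × (∀ S → S ∈L supp 𝒟 → Σ-over (elems M) (λ u → x u S) ≡ 1ℚ)
    × (∀ u S → u ∈ M → S ∈L supp 𝒟 → 0ℚ ≤ x u S)

  ExtremePoint : Dist n → Subset n → (Subset n → Fin n → Fin n) →
                 (Fin n → Subset n → ℚ) → Set
  ExtremePoint 𝒟 M g x =
      Feasible 𝒟 M g x
    × (∀ y z → Feasible 𝒟 M g y → Feasible 𝒟 M g z →
         (∀ u S → u ∈ M → S ∈L supp 𝒟 → x u S ≡ ½ * (y u S + z u S)) →
         ∀ u S → u ∈ M → S ∈L supp 𝒟 → y u S ≡ z u S)

  step : Dist n → Subset n → (Subset n → Fin n → Fin n) →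
         (Fin n → Subset n → ℚ) → Dist n
  step 𝒟 M g x =
    concatMap (λ S → concatMap (λ u →
        keepIf (0ℚ <? x u S) (x u S * Pr 𝒟 S , (S +ₑ u) -ₑ g S u))
      (elems M)) (supp 𝒟)

  dist : Subset n → (ℕ → Subset n) → (ℕ → Subset n → Fin n → Fin n) →
         (ℕ → Fin n → Subset n → ℚ) → ℕ → Dist n
  dist S₀ M g x zero    = [ (1ℚ , S₀) ]
  dist S₀ M g x (suc i) = step (dist S₀ M g x i) (M (suc i)) (g (suc i)) (x (suc i))

  record Run : Set where
    field
      S₀       : Subset n
      M        : ℕ → Subset n
      g        : ℕ → Subset n → Fin n → Fin n
      x        : ℕ → Fin n → Subset n → ℚ
      S₀-base  : Base S₀
      S₀-dummy : S₀ ⊆ D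
      M-base   : ∀ i → i < k → Base (M (suc i))
      M-max    : ∀ i → i < k → ∀ B → Base B →
                 score (dist S₀ M g x i) B ≤ score (dist S₀ M g x i) (M (suc i))
      g-exch   : ∀ i → i < k → ∀ S → S ∈L supp (dist S₀ M g x i) →
                 ExchangeMap (M (suc i)) S (g (suc i) S)
      x-ext    : ∀ i → i < k →
                 ExtremePoint (dist S₀ M g x i) (M (suc i)) (g (suc i)) (x (suc i))

    𝒟 : ℕ → Dist n
    𝒟 = dist S₀ M g x

-- Write p = Pr[u ∉ S] and q = Pr[u ∈ S] = 1 - p.  In one step u can only
-- enter S as the element chosen at S, which by the third constraint of (P)
-- has probability at most p/k, while the fourth constraint makes u leave
-- with probability at least q/k.  Hence the next p is at least
-- p - p/k + (1 - p)/k = (1 - 2/k) p + 1/k.  The initial base consists of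
-- dummies, so p = 1 at the start, and ½(1 + (1 - 2/k)^i) is exactly the
-- solution of the recurrence t' = (1 - 2/k) t + 1/k with t = 1 at i = 0.
-- Along the way one keeps that the weights stay non-negative with total
-- mass 1, because each x(·, S) is a probability vector.

{-# OPTIONS --safe #-}
module Submission where

open import Defs
open import Data.Nat using (ℕ; NonZero) renaming (_≤_ to _≤ℕ_)
open import Data.Fin using (Fin)
open import Data.Fin.Subset using (Subset; _∉_)
open import Data.Integer using (+_)
open import Data.Rational using (ℚ; 1ℚ; ½; _+_; _*_; _-_; _≤_; _/_)

open import Level using (0ℓ)
open import Data.Nat using (suc; zero; s≤s; z≤n)
import Data.Nat.Properties as ℕ
open import Function using (_∘_)
open import Data.Fin using () renaming (_≟_ to _≟F_)
open import Data.Fin.Subset using (_∈_; _─_; ⁅_⁆; outside)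
open import Data.Vec using (_∷_; here; there)
open import Data.Fin.Subset.Properties using (_∈?_; x∈⁅x⁆; x∈⁅y⁆⇒x≡y; x∈p∪q⁻; p─q⊆p)
import Data.Integer as ℤ
import Data.Integer.Tactic.RingSolver as ℤ-Solver
open import Data.Rational using (0ℚ; -_; nonNegative; toℚᵘ)
open import Data.Rational.Properties
  using (+-*-commutativeRing; +-0-commutativeMonoid; _≟_; _<?_; ≤ᵇ⇒≤; ≮⇒≥; <⇒≤;
         ≤-refl; ≤-reflexive; ≤-trans; ≤-antisym; module ≤-Reasoning;
         +-assoc; +-identityˡ; +-identityʳ; +-inverseʳ; neg-distrib-+;
         *-comm; *-identityˡ; *-identityʳ; *-zeroˡ; *-zeroʳ; *-distribˡ-+;
         +-mono-≤; +-monoˡ-≤; +-monoʳ-≤; neg-antimono-≤; *-monoˡ-≤-nonNeg;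
         nonNegative⁻¹; nonNeg*nonNeg⇒nonNeg; normalize-nonNeg;
         toℚᵘ-injective; toℚᵘ-fromℚᵘ; toℚᵘ-homo-+; toℚᵘ-cancel-≤)
open import Data.Rational.Unnormalised as ℚᵘ using (mkℚᵘ; *≡*; *≤*)
import Data.Rational.Unnormalised.Properties as ℚᵘ
open import Algebra.Bundles using (CommutativeMonoid)
open import Algebra.Properties.CommutativeSemigroup
  (CommutativeMonoid.commutativeSemigroup +-0-commutativeMonoid) using (interchange)
open import Tactic.RingSolver.Core.AlmostCommutativeRing
  using (AlmostCommutativeRing; fromCommutativeRing)
open import Tactic.RingSolver using (solve-∀)
open import Relation.Nullary.Decidable.Core using (dec⇒maybe)
open import Relation.Binary.PropositionalEquality
open import Relation.Binary.Definitions using (DecidableEquality)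
open import Relation.Nullary using (Dec; yes; no; ¬?)
open import Data.Empty using (⊥-elim)
open import Data.Unit using (tt)
open import Data.Product using (_×_; _,_; proj₁; proj₂)
open import Data.Sum using (inj₁; inj₂)
open import Data.List using (List; []; _∷_; map; concatMap; _++_; allFin)
open import Data.List.Relation.Unary.All using (All; []; _∷_)
open import Data.List.Relation.Unary.All.Properties using (All¬⇒¬Any; ++⁺)
open import Data.List.Relation.Unary.Any using (here; there)
open import Data.List.Membership.Propositional using () renaming (_∈_ to _∈L_; _∉_ to _∉L_)
open import Data.List.Membership.Propositional.Properties
  using (∈-filter⁺; ∈-filter⁻; ∈-allFin; ∈-map⁺; ∈-deduplicate⁺)
open import Data.List.Relation.Unary.Unique.Propositional using (Unique)
open import Data.List.Relation.Unary.AllPairs using (_∷_)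
import Data.List.Relation.Unary.Unique.Propositional.Properties as Unique
import Data.List.Relation.Unary.Unique.DecPropositional.Properties as UniqueDec

ℚ-ring : AlmostCommutativeRing 0ℓ 0ℓ
ℚ-ring = fromCommutativeRing +-*-commutativeRing (λ q → dec⇒maybe (0ℚ ≟ q))

*-nonNeg : ∀ {p q} → 0ℚ ≤ p → 0ℚ ≤ q → 0ℚ ≤ p * q
*-nonNeg {p} {q} 0≤p 0≤q =
  nonNegative⁻¹ (p * q) {{nonNeg*nonNeg⇒nonNeg p {{nonNegative 0≤p}} q {{nonNegative 0≤q}}}}

*-monoˡ-≤-0≤ : ∀ {r p q} → 0ℚ ≤ r → p ≤ q → r * p ≤ r * q
*-monoˡ-≤-0≤ {r} 0≤r = *-monoˡ-≤-nonNeg r {{nonNegative 0≤r}}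

p≤q⇒0≤q-p : ∀ {p q} → p ≤ q → 0ℚ ≤ q - p
p≤q⇒0≤q-p {p} p≤q = ≤-trans (≤-reflexive (sym (+-inverseʳ p))) (+-monoˡ-≤ (- p) p≤q)

𝟙-nonNeg : ∀ {P : Set} (d : Dec P) → 0ℚ ≤ 𝟙 d
𝟙-nonNeg (yes _) = ≤ᵇ⇒≤ tt
𝟙-nonNeg (no _)  = ≤-refl

𝟙-¬?+𝟙 : ∀ {P : Set} (d : Dec P) → 𝟙 (¬? d) + 𝟙 d ≡ 1ℚ
𝟙-¬?+𝟙 (yes _) = refl
𝟙-¬?+𝟙 (no _)  = refl

module _ {A : Set} where

  Σ-over-cong : ∀ (xs : List A) {h h′ : A → ℚ} →
                (∀ a → a ∈L xs → h a ≡ h′ a) → Σ-over xs h ≡ Σ-over xs h′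
  Σ-over-cong []       eq = refl
  Σ-over-cong (x ∷ xs) eq = cong₂ _+_ (eq x (here refl)) (Σ-over-cong xs (λ a → eq a ∘ there))

  Σ-over-mono : ∀ (xs : List A) {h h′ : A → ℚ} →
                (∀ a → a ∈L xs → h a ≤ h′ a) → Σ-over xs h ≤ Σ-over xs h′
  Σ-over-mono []       le = ≤-refl
  Σ-over-mono (x ∷ xs) le = +-mono-≤ (le x (here refl)) (Σ-over-mono xs (λ a a∈ → le a (there a∈)))

  Σ-over-nonNeg : ∀ (xs : List A) {h : A → ℚ} → (∀ a → a ∈L xs → 0ℚ ≤ h a) → 0ℚ ≤ Σ-over xs h
  Σ-over-nonNeg []       le = ≤-refl
  Σ-over-nonNeg (x ∷ xs) le =
    +-mono-≤ (le x (here refl)) (Σ-over-nonNeg xs (λ a a∈ → le a (there a∈)))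

  Σ-over-+ : ∀ (xs : List A) (h h′ : A → ℚ) →
             Σ-over xs (λ a → h a + h′ a) ≡ Σ-over xs h + Σ-over xs h′
  Σ-over-+ []       h h′ = refl
  Σ-over-+ (x ∷ xs) h h′ =
    trans (cong (_+_ (h x + h′ x)) (Σ-over-+ xs h h′)) (interchange (h x) (h′ x) _ _)

  Σ-over-neg : ∀ (xs : List A) (h : A → ℚ) → Σ-over xs (λ a → - h a) ≡ - Σ-over xs h
  Σ-over-neg []       h = refl
  Σ-over-neg (x ∷ xs) h =
    trans (cong (_+_ (- h x)) (Σ-over-neg xs h)) (sym (neg-distrib-+ (h x) (Σ-over xs h)))

  Σ-over-- : ∀ (xs : List A) (h h′ : A → ℚ) →
             Σ-over xs (λ a → h a - h′ a) ≡ Σ-over xs h - Σ-over xs h′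
  Σ-over-- xs h h′ =
    trans (Σ-over-+ xs h (λ a → - h′ a)) (cong (_+_ (Σ-over xs h)) (Σ-over-neg xs h′))

  Σ-over-*ˡ : ∀ (xs : List A) c (h : A → ℚ) → Σ-over xs (λ a → c * h a) ≡ c * Σ-over xs h
  Σ-over-*ˡ []       c h = sym (*-zeroʳ c)
  Σ-over-*ˡ (x ∷ xs) c h =
    trans (cong (_+_ (c * h x)) (Σ-over-*ˡ xs c h)) (sym (*-distribˡ-+ c (h x) (Σ-over xs h)))

  Σ-over-*ʳ : ∀ (xs : List A) c (h : A → ℚ) → Σ-over xs (λ a → h a * c) ≡ Σ-over xs h * c
  Σ-over-*ʳ xs c h = trans (Σ-over-cong xs (λ a _ → *-comm (h a) c))
                           (trans (Σ-over-*ˡ xs c h) (*-comm c (Σ-over xs h)))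

  module _ (_≟_ : DecidableEquality A) where

    𝟙-≟-sym : ∀ a b → 𝟙 (a ≟ b) ≡ 𝟙 (b ≟ a)
    𝟙-≟-sym a b with a ≟ b | b ≟ a
    ... | yes _   | yes _   = refl
    ... | no _    | no _    = refl
    ... | yes a≡b | no b≢a  = ⊥-elim (b≢a (sym a≡b))
    ... | no a≢b  | yes b≡a = ⊥-elim (a≢b (sym b≡a))

    Σ-over-𝟙-∉ : ∀ (xs : List A) b (c : A → ℚ) → b ∉L xs →
                 Σ-over xs (λ a → c a * 𝟙 (a ≟ b)) ≡ 0ℚ
    Σ-over-𝟙-∉ []       b c b∉ = refl
    Σ-over-𝟙-∉ (x ∷ xs) b c b∉ with x ≟ b
    ... | yes x≡b = ⊥-elim (b∉ (here (sym x≡b)))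
    ... | no _    = cong₂ _+_ (*-zeroʳ (c x)) (Σ-over-𝟙-∉ xs b c (λ b∈ → b∉ (there b∈)))

    Σ-over-𝟙-∈ : ∀ (xs : List A) b (c : A → ℚ) → Unique xs → b ∈L xs →
                 Σ-over xs (λ a → c a * 𝟙 (a ≟ b)) ≡ c b
    Σ-over-𝟙-∈ (x ∷ xs) b c (x∉ ∷ _) b∈ with x ≟ b
    Σ-over-𝟙-∈ (x ∷ xs) b c (x∉ ∷ _) b∈         | yes refl =
      trans (cong₂ _+_ (*-identityʳ (c x)) (Σ-over-𝟙-∉ xs x c (All¬⇒¬Any x∉)))
            (+-identityʳ (c x))
    Σ-over-𝟙-∈ (x ∷ xs) b c (_ ∷ _)  (here b≡x) | no x≢b = ⊥-elim (x≢b (sym b≡x))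
    Σ-over-𝟙-∈ (x ∷ xs) b c (_ ∷ u)  (there b∈) | no _ =
      trans (cong₂ _+_ (*-zeroʳ (c x)) (Σ-over-𝟙-∈ xs b c u b∈)) (+-identityˡ (c b))

module _ {n : ℕ} where

  elems-unique : ∀ (M : Subset n) → Unique (elems M)
  elems-unique M = Unique.filter⁺ (_∈? M) (Unique.allFin⁺ n)

  ∈-elems⁻ : ∀ {M : Subset n} {v} → v ∈L elems M → v ∈ M
  ∈-elems⁻ {M} v∈ = proj₂ (∈-filter⁻ (_∈? M) {xs = allFin n} v∈)

  ∈-elems⁺ : ∀ {M : Subset n} {v} → v ∈ M → v ∈L elems M
  ∈-elems⁺ {M} {v} v∈ = ∈-filter⁺ (_∈? M) (∈-allFin v) v∈

  -- 𝔼 merges equal sets through supp and Pr; summing pair by pair instead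
  -- is what commutes with the concatMap in step.
  𝔼ₘ : Dist n → (Subset n → ℚ) → ℚ
  𝔼ₘ 𝒟 h = Σ-over 𝒟 (λ (p , S) → p * h S)

  NonNegWeights : Dist n → Set
  NonNegWeights 𝒟 = All (λ (p , _) → 0ℚ ≤ p) 𝒟

  mass : Dist n → ℚ
  mass 𝒟 = 𝔼 𝒟 (λ _ → 1ℚ)

  Pr-∷ : ∀ (p : ℚ) (T : Subset n) 𝒟 S → Pr ((p , T) ∷ 𝒟) S ≡ p * 𝟙 (T ≟S S) + Pr 𝒟 S
  Pr-∷ p T 𝒟 S with T ≟S S
  ... | yes _ = cong (_+ Pr 𝒟 S) (sym (*-identityʳ p))
  ... | no _  = sym (trans (cong (_+ Pr 𝒟 S) (*-zeroʳ p)) (+-identityˡ (Pr 𝒟 S)))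

  Σ-Pr≡𝔼ₘ : ∀ (U : List (Subset n)) → Unique U → (h : Subset n → ℚ) → ∀ 𝒟 →
            (∀ e → e ∈L 𝒟 → proj₂ e ∈L U) → Σ-over U (λ S → Pr 𝒟 S * h S) ≡ 𝔼ₘ 𝒟 h
  Σ-Pr≡𝔼ₘ U _ h [] _ = trans (Σ-over-*ˡ U 0ℚ h) (*-zeroˡ (Σ-over U h))
  Σ-Pr≡𝔼ₘ U U-unique h ((p , T) ∷ 𝒟) ⊆U = begin
    Σ-over U (λ S → Pr ((p , T) ∷ 𝒟) S * h S)
      ≡⟨ Σ-over-cong U (λ S _ → split S) ⟩
    Σ-over U (λ S → p * h S * 𝟙 (S ≟S T) + Pr 𝒟 S * h S)
      ≡⟨ Σ-over-+ U (λ S → p * h S * 𝟙 (S ≟S T)) (λ S → Pr 𝒟 S * h S) ⟩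
    Σ-over U (λ S → p * h S * 𝟙 (S ≟S T)) + Σ-over U (λ S → Pr 𝒟 S * h S)
      ≡⟨ cong₂ _+_ (Σ-over-𝟙-∈ _≟S_ U T (λ S → p * h S) U-unique (⊆U (p , T) (here refl)))
                   (Σ-Pr≡𝔼ₘ U U-unique h 𝒟 (λ e e∈ → ⊆U e (there e∈))) ⟩
    p * h T + 𝔼ₘ 𝒟 h ∎
    where
    open ≡-Reasoning
    rearrange : ∀ p i P y → (p * i + P) * y ≡ p * y * i + P * y
    rearrange = solve-∀ ℚ-ring
    split : ∀ S → Pr ((p , T) ∷ 𝒟) S * h S ≡ p * h S * 𝟙 (S ≟S T) + Pr 𝒟 S * h S
    split S = begin
      Pr ((p , T) ∷ 𝒟) S * h S              ≡⟨ cong (_* h S) (Pr-∷ p T 𝒟 S) ⟩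
      (p * 𝟙 (T ≟S S) + Pr 𝒟 S) * h S       ≡⟨ cong (λ i → (p * i + Pr 𝒟 S) * h S) (𝟙-≟-sym _≟S_ T S) ⟩
      (p * 𝟙 (S ≟S T) + Pr 𝒟 S) * h S       ≡⟨ rearrange p _ (Pr 𝒟 S) (h S) ⟩
      p * h S * 𝟙 (S ≟S T) + Pr 𝒟 S * h S   ∎

  𝔼≡𝔼ₘ : ∀ (𝒟 : Dist n) h → 𝔼 𝒟 h ≡ 𝔼ₘ 𝒟 h
  𝔼≡𝔼ₘ 𝒟 h = Σ-Pr≡𝔼ₘ (supp 𝒟) (UniqueDec.deduplicate-! _≟S_ (map proj₂ 𝒟)) h 𝒟
               (λ e e∈ → ∈-deduplicate⁺ _≟S_ (∈-map⁺ proj₂ e∈))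

  Pr-nonNeg : ∀ (𝒟 : Dist n) → NonNegWeights 𝒟 → ∀ S → 0ℚ ≤ Pr 𝒟 S
  Pr-nonNeg []            _          S = ≤-refl
  Pr-nonNeg ((p , T) ∷ 𝒟) (0≤p ∷ nn) S = ≤-trans
    (+-mono-≤ (*-nonNeg 0≤p (𝟙-nonNeg (T ≟S S))) (Pr-nonNeg 𝒟 nn S))
    (≤-reflexive (sym (Pr-∷ p T 𝒟 S)))

  𝔼-mono : ∀ (𝒟 : Dist n) → NonNegWeights 𝒟 → {h h′ : Subset n → ℚ} →
           (∀ S → S ∈L supp 𝒟 → h S ≤ h′ S) → 𝔼 𝒟 h ≤ 𝔼 𝒟 h′
  𝔼-mono 𝒟 nn le = Σ-over-mono (supp 𝒟) (λ S S∈ → *-monoˡ-≤-0≤ (Pr-nonNeg 𝒟 nn S) (le S S∈))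

  𝔼-nonNeg : ∀ (𝒟 : Dist n) → NonNegWeights 𝒟 → {h : Subset n → ℚ} →
             (∀ S → 0ℚ ≤ h S) → 0ℚ ≤ 𝔼 𝒟 h
  𝔼-nonNeg 𝒟 nn 0≤h = Σ-over-nonNeg (supp 𝒟) (λ S _ → *-nonNeg (Pr-nonNeg 𝒟 nn S) (0≤h S))

  𝔼-cong : ∀ (𝒟 : Dist n) {h h′ : Subset n → ℚ} →
           (∀ S → S ∈L supp 𝒟 → h S ≡ h′ S) → 𝔼 𝒟 h ≡ 𝔼 𝒟 h′
  𝔼-cong 𝒟 eq = Σ-over-cong (supp 𝒟) (λ S S∈ → cong (Pr 𝒟 S *_) (eq S S∈))

  𝔼-zero : ∀ (𝒟 : Dist n) → 𝔼 𝒟 (λ _ → 0ℚ) ≡ 0ℚ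
  𝔼-zero 𝒟 = trans (Σ-over-*ʳ (supp 𝒟) 0ℚ (Pr 𝒟)) (*-zeroʳ (Σ-over (supp 𝒟) (Pr 𝒟)))

  𝔼-+- : ∀ (𝒟 : Dist n) (h₁ h₂ h₃ : Subset n → ℚ) →
         𝔼 𝒟 (λ S → h₁ S + h₂ S - h₃ S) ≡ 𝔼 𝒟 h₁ + 𝔼 𝒟 h₂ - 𝔼 𝒟 h₃
  𝔼-+- 𝒟 h₁ h₂ h₃ = begin
    Σ-over U (λ S → Pr 𝒟 S * (h₁ S + h₂ S - h₃ S))
      ≡⟨ Σ-over-cong U (λ S _ → distrib (Pr 𝒟 S) (h₁ S) (h₂ S) (h₃ S)) ⟩
    Σ-over U (λ S → Pr 𝒟 S * h₁ S + Pr 𝒟 S * h₂ S - Pr 𝒟 S * h₃ S)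
      ≡⟨ Σ-over-- U (λ S → Pr 𝒟 S * h₁ S + Pr 𝒟 S * h₂ S) (λ S → Pr 𝒟 S * h₃ S) ⟩
    Σ-over U (λ S → Pr 𝒟 S * h₁ S + Pr 𝒟 S * h₂ S) - 𝔼 𝒟 h₃
      ≡⟨ cong (_- 𝔼 𝒟 h₃) (Σ-over-+ U (λ S → Pr 𝒟 S * h₁ S) (λ S → Pr 𝒟 S * h₂ S)) ⟩
    𝔼 𝒟 h₁ + 𝔼 𝒟 h₂ - 𝔼 𝒟 h₃ ∎
    where
    open ≡-Reasoning
    U = supp 𝒟
    distrib : ∀ p a b c → p * (a + b - c) ≡ p * a + p * b - p * c
    distrib = solve-∀ ℚ-ring

  PrNotIn+PrIn≡mass : ∀ (𝒟 : Dist n) u → PrNotIn 𝒟 u + PrIn 𝒟 u ≡ mass 𝒟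
  PrNotIn+PrIn≡mass 𝒟 u = trans
    (sym (Σ-over-+ (supp 𝒟) (λ S → Pr 𝒟 S * 𝟙 (¬? (u ∈? S))) (λ S → Pr 𝒟 S * 𝟙 (u ∈? S))))
    (Σ-over-cong (supp 𝒟) (λ S _ →
      trans (sym (*-distribˡ-+ (Pr 𝒟 S) _ _)) (cong (Pr 𝒟 S *_) (𝟙-¬?+𝟙 (u ∈? S)))))

  𝔼ₘ-concatMap : ∀ {B : Set} (F : B → Dist n) (xs : List B) h →
                 𝔼ₘ (concatMap F xs) h ≡ Σ-over xs (λ b → 𝔼ₘ (F b) h)
  𝔼ₘ-concatMap F []       h = refl
  𝔼ₘ-concatMap F (x ∷ xs) h =
    trans (𝔼ₘ-++ (F x) (concatMap F xs)) (cong (_+_ (𝔼ₘ (F x) h)) (𝔼ₘ-concatMap F xs h))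
    where
    𝔼ₘ-++ : ∀ (𝒟 𝒟′ : Dist n) → 𝔼ₘ (𝒟 ++ 𝒟′) h ≡ 𝔼ₘ 𝒟 h + 𝔼ₘ 𝒟′ h
    𝔼ₘ-++ []            𝒟′ = sym (+-identityˡ (𝔼ₘ 𝒟′ h))
    𝔼ₘ-++ ((p , S) ∷ 𝒟) 𝒟′ =
      trans (cong (_+_ (p * h S)) (𝔼ₘ-++ 𝒟 𝒟′)) (sym (+-assoc (p * h S) (𝔼ₘ 𝒟 h) (𝔼ₘ 𝒟′ h)))

  nonNegWeights-concatMap : ∀ {B : Set} (F : B → Dist n) (xs : List B) →
                            (∀ b → b ∈L xs → NonNegWeights (F b)) →
                            NonNegWeights (concatMap F xs)
  nonNegWeights-concatMap F []       _  = []
  nonNegWeights-concatMap F (x ∷ xs) nn =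
    ++⁺ (nn x (here refl)) (nonNegWeights-concatMap F xs (λ b b∈ → nn b (there b∈)))

  -- keepIf drops the pairs with x = 0, which contribute nothing anyway.
  𝔼ₘ-keepIf : ∀ (h : Subset n → ℚ) (x w : ℚ) T → 0ℚ ≤ x →
              𝔼ₘ (keepIf (0ℚ <? x) (x * w , T)) h ≡ w * (x * h T)
  𝔼ₘ-keepIf h x w T 0≤x with 0ℚ <? x
  ... | yes _ = trans (+-identityʳ (x * w * h T)) (reorder x w (h T))
    where
    reorder : ∀ a b c → a * b * c ≡ b * (a * c)
    reorder = solve-∀ ℚ-ring
  ... | no 0≮x with ≤-antisym (≮⇒≥ 0≮x) 0≤x
  ...   | refl = sym (trans (cong (w *_) (*-zeroˡ (h T))) (*-zeroʳ w))

  nonNegWeights-keepIf : ∀ (x w : ℚ) (T : Subset n) → 0ℚ ≤ w →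
                         NonNegWeights (keepIf (0ℚ <? x) (x * w , T))
  nonNegWeights-keepIf x w T 0≤w with 0ℚ <? x
  ... | yes 0<x = *-nonNeg (<⇒≤ 0<x) 0≤w ∷ []
  ... | no _    = []

x∈p─q⇒x∉q : ∀ {n} {p q : Subset n} {x} → x ∈ p ─ q → x ∉ q
x∈p─q⇒x∉q {p = _ ∷ _} {outside ∷ _} here       ()
x∈p─q⇒x∉q {p = _ ∷ p} {_ ∷ q}       (there x∈) (there x∈q) = x∈p─q⇒x∉q {p = p} {q} x∈ x∈q

module _ {n : ℕ} where

  ∉-swap-out : ∀ (S : Subset n) v u → u ∉ (S +ₑ v) -ₑ u
  ∉-swap-out S v u u∈ = x∈p─q⇒x∉q u∈ (x∈⁅x⁆ u)

  ∉-swap-in : ∀ {S : Subset n} {u v} w → u ∉ S → v ≢ u → u ∉ (S +ₑ v) -ₑ w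
  ∉-swap-in {S} {u} {v} w u∉S v≢u u∈ with x∈p∪q⁻ S ⁅ v ⁆ (p─q⊆p (S +ₑ v) ⁅ w ⁆ u∈)
  ... | inj₁ u∈S = u∉S u∈S
  ... | inj₂ u∈v = v≢u (sym (x∈⁅y⁆⇒x≡y v u∈v))

  -- u is outside S + v - w unless it was outside S and v = u, or inside S and w ≠ u.
  𝟙∉-swap : ∀ (S : Subset n) u v w →
            𝟙 (¬? (u ∈? S)) + 𝟙 (w ≟F u) * 𝟙 (u ∈? S) - 𝟙 (v ≟F u) * 𝟙 (¬? (u ∈? S))
              ≤ 𝟙 (¬? (u ∈? (S +ₑ v) -ₑ w))
  𝟙∉-swap S u v w with u ∈? (S +ₑ v) -ₑ w
  ... | no _ = ≤1 (u ∈? S) (v ≟F u) (w ≟F u)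
    where
    ≤1 : ∀ {P Q R : Set} (a : Dec P) (b : Dec Q) (c : Dec R) →
         𝟙 (¬? a) + 𝟙 c * 𝟙 a - 𝟙 b * 𝟙 (¬? a) ≤ 1ℚ
    ≤1 (yes _) (yes _) (yes _) = ≤ᵇ⇒≤ tt
    ≤1 (yes _) (yes _) (no _)  = ≤ᵇ⇒≤ tt
    ≤1 (yes _) (no _)  (yes _) = ≤ᵇ⇒≤ tt
    ≤1 (yes _) (no _)  (no _)  = ≤ᵇ⇒≤ tt
    ≤1 (no _)  (yes _) (yes _) = ≤ᵇ⇒≤ tt
    ≤1 (no _)  (yes _) (no _)  = ≤ᵇ⇒≤ tt
    ≤1 (no _)  (no _)  (yes _) = ≤ᵇ⇒≤ tt
    ≤1 (no _)  (no _)  (no _)  = ≤ᵇ⇒≤ tt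
  ... | yes u∈swap with u ∈? S | v ≟F u | w ≟F u
  ...   | yes _   | _       | yes refl = ⊥-elim (∉-swap-out S v u u∈swap)
  ...   | yes _   | yes _   | no _     = ≤ᵇ⇒≤ tt
  ...   | yes _   | no _    | no _     = ≤ᵇ⇒≤ tt
  ...   | no _    | yes _   | yes _    = ≤ᵇ⇒≤ tt
  ...   | no _    | yes _   | no _     = ≤ᵇ⇒≤ tt
  ...   | no u∉S  | no v≢u  | _        = ⊥-elim (∉-swap-in w u∉S v≢u u∈swap)

module Step {n : ℕ} (k : ℕ) {{_ : NonZero k}} (D : Subset n)
            (f₀ : Subset n → ℚ) (I₀ : Subset n → Set)
            (𝒟 : Dist n) (M : Subset n) (g : Subset n → Fin n → Fin n)
            (x : Fin n → Subset n → ℚ)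
            (𝒟-nonNeg : NonNegWeights 𝒟) (feasible : DRG.Feasible k D f₀ I₀ 𝒟 M g x) where

  open DRG k D f₀ I₀ using (1/k; step)

  entry-bound : ∀ u → u ∈ M → 𝔼 𝒟 (λ S → x u S * 𝟙 (¬? (u ∈? S))) ≤ 1/k * PrNotIn 𝒟 u
  entry-bound = proj₁ (proj₂ (proj₂ feasible))

  exit-bound : ∀ u → 1/k * PrIn 𝒟 u
                 ≤ 𝔼 𝒟 (λ S → Σ-over (elems M) (λ v → x v S * 𝟙 (g S v ≟F u)) * 𝟙 (u ∈? S))
  exit-bound = proj₁ (proj₂ (proj₂ (proj₂ feasible)))

  x-sum : ∀ S → S ∈L supp 𝒟 → Σ-over (elems M) (λ v → x v S) ≡ 1ℚ
  x-sum = proj₁ (proj₂ (proj₂ (proj₂ (proj₂ feasible))))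

  x-nonNeg : ∀ v S → v ∈ M → S ∈L supp 𝒟 → 0ℚ ≤ x v S
  x-nonNeg = proj₂ (proj₂ (proj₂ (proj₂ (proj₂ feasible))))

  swap : Subset n → Fin n → Subset n
  swap S v = (S +ₑ v) -ₑ g S v

  𝔼ₘ-step : ∀ h → 𝔼ₘ (step 𝒟 M g x) h ≡ 𝔼 𝒟 (λ S → Σ-over (elems M) (λ v → x v S * h (swap S v)))
  𝔼ₘ-step h = trans (𝔼ₘ-concatMap _ (supp 𝒟) h) (Σ-over-cong (supp 𝒟) λ S S∈ →
    trans (𝔼ₘ-concatMap _ (elems M) h)
      (trans (Σ-over-cong (elems M) λ v v∈ →
                𝔼ₘ-keepIf h (x v S) (Pr 𝒟 S) (swap S v) (x-nonNeg v S (∈-elems⁻ v∈) S∈))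
             (Σ-over-*ˡ (elems M) (Pr 𝒟 S) (λ v → x v S * h (swap S v)))))

  step-nonNeg : NonNegWeights (step 𝒟 M g x)
  step-nonNeg = nonNegWeights-concatMap _ (supp 𝒟) λ S _ →
    nonNegWeights-concatMap _ (elems M) λ v _ →
      nonNegWeights-keepIf (x v S) (Pr 𝒟 S) (swap S v) (Pr-nonNeg 𝒟 𝒟-nonNeg S)

  mass-step : mass (step 𝒟 M g x) ≡ mass 𝒟
  mass-step = trans (𝔼≡𝔼ₘ (step 𝒟 M g x) _) (trans (𝔼ₘ-step (λ _ → 1ℚ)) (𝔼-cong 𝒟 λ S S∈ →
    trans (Σ-over-cong (elems M) (λ v _ → *-identityʳ (x v S))) (x-sum S S∈)))

  module _ (u : Fin n) where

    private
      in? out? : Subset n → ℚ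
      in? S  = 𝟙 (u ∈? S)
      out? S = 𝟙 (¬? (u ∈? S))

      enters leaves : Subset n → ℚ
      enters S = Σ-over (elems M) (λ v → x v S * 𝟙 (v ≟F u))
      leaves S = Σ-over (elems M) (λ v → x v S * 𝟙 (g S v ≟F u))

    enter-bound : 𝔼 𝒟 (λ S → enters S * out? S) ≤ 1/k * PrNotIn 𝒟 u
    enter-bound with u ∈? M
    ... | yes u∈M = ≤-trans
      (≤-reflexive (𝔼-cong 𝒟 λ S _ →
        cong (_* out? S) (Σ-over-𝟙-∈ _≟F_ (elems M) u (λ v → x v S) (elems-unique M) (∈-elems⁺ u∈M))))
      (entry-bound u u∈M)
    ... | no u∉M = ≤-trans
      (≤-reflexive (trans (𝔼-cong 𝒟 λ S _ →
          trans (cong (_* out? S) (Σ-over-𝟙-∉ _≟F_ (elems M) u (λ v → x v S) (u∉M ∘ ∈-elems⁻)))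
                (*-zeroˡ (out? S)))
        (𝔼-zero 𝒟)))
      (*-nonNeg (nonNegative⁻¹ 1/k {{normalize-nonNeg 1 k}})
                (𝔼-nonNeg 𝒟 𝒟-nonNeg (λ S → 𝟙-nonNeg (¬? (u ∈? S)))))

    Σ-x-swap : ∀ S → S ∈L supp 𝒟 →
               Σ-over (elems M) (λ v → x v S * (out? S + 𝟙 (g S v ≟F u) * in? S - 𝟙 (v ≟F u) * out? S))
                 ≡ out? S + leaves S * in? S - enters S * out? S
    Σ-x-swap S S∈ = begin
      Σ-over V (λ v → x v S * (b + δg v * a - δ v * b))
        ≡⟨ Σ-over-cong V (λ v _ → distrib (x v S) b a (δg v) (δ v)) ⟩
      Σ-over V (λ v → x v S * b + x v S * δg v * a - x v S * δ v * b)
        ≡⟨ Σ-over-- V (λ v → x v S * b + x v S * δg v * a) (λ v → x v S * δ v * b) ⟩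
      Σ-over V (λ v → x v S * b + x v S * δg v * a) - Σ-over V (λ v → x v S * δ v * b)
        ≡⟨ cong (_- Σ-over V (λ v → x v S * δ v * b)) (Σ-over-+ V (λ v → x v S * b) (λ v → x v S * δg v * a)) ⟩
      Σ-over V (λ v → x v S * b) + Σ-over V (λ v → x v S * δg v * a) - Σ-over V (λ v → x v S * δ v * b)
        ≡⟨ cong₂ _-_ (cong₂ _+_ (Σ-over-*ʳ V b (λ v → x v S)) (Σ-over-*ʳ V a (λ v → x v S * δg v)))
                     (Σ-over-*ʳ V b (λ v → x v S * δ v)) ⟩
      Σ-over V (λ v → x v S) * b + leaves S * a - enters S * b
        ≡⟨ cong (λ t → t * b + leaves S * a - enters S * b) (x-sum S S∈) ⟩
      1ℚ * b + leaves S * a - enters S * b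
        ≡⟨ cong (λ t → t + leaves S * a - enters S * b) (*-identityˡ b) ⟩
      b + leaves S * a - enters S * b ∎
      where
      open ≡-Reasoning
      V = elems M
      a = in? S
      b = out? S
      δ δg : Fin n → ℚ
      δ v  = 𝟙 (v ≟F u)
      δg v = 𝟙 (g S v ≟F u)
      distrib : ∀ x b a e d → x * (b + e * a - d * b) ≡ x * b + x * e * a - x * d * b
      distrib = solve-∀ ℚ-ring

    PrNotIn-step : PrNotIn 𝒟 u + 1/k * PrIn 𝒟 u - 1/k * PrNotIn 𝒟 u ≤ PrNotIn (step 𝒟 M g x) u
    PrNotIn-step = begin
      PrNotIn 𝒟 u + 1/k * PrIn 𝒟 u - 1/k * PrNotIn 𝒟 u
        ≤⟨ +-mono-≤ (+-monoʳ-≤ (PrNotIn 𝒟 u) (exit-bound u)) (neg-antimono-≤ enter-bound) ⟩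
      PrNotIn 𝒟 u + 𝔼 𝒟 (λ S → leaves S * in? S) - 𝔼 𝒟 (λ S → enters S * out? S)
        ≡⟨ 𝔼-+- 𝒟 out? (λ S → leaves S * in? S) (λ S → enters S * out? S) ⟨
      𝔼 𝒟 (λ S → out? S + leaves S * in? S - enters S * out? S)
        ≤⟨ 𝔼-mono 𝒟 𝒟-nonNeg (λ S S∈ → ≤-trans (≤-reflexive (sym (Σ-x-swap S S∈)))
             (Σ-over-mono (elems M) λ v v∈ →
               *-monoˡ-≤-0≤ (x-nonNeg v S (∈-elems⁻ v∈) S∈) (𝟙∉-swap S u v (g S v)))) ⟩
      𝔼 𝒟 (λ S → Σ-over (elems M) (λ v → x v S * out? (swap S v)))
        ≡⟨ trans (𝔼≡𝔼ₘ (step 𝒟 M g x) out?) (𝔼ₘ-step out?) ⟨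
      PrNotIn (step 𝒟 M g x) u ∎
      where open ≤-Reasoning

2/k≡1/k+1/k : ∀ k .{{_ : NonZero k}} → + 2 / k ≡ + 1 / k + + 1 / k
2/k≡1/k+1/k (suc d) = toℚᵘ-injective (begin
  toℚᵘ (+ 2 / suc d)                       ≈⟨ toℚᵘ-fromℚᵘ (mkℚᵘ (+ 2) d) ⟩
  mkℚᵘ (+ 2) d                             ≈⟨ *≡* (cross-multiplied ℤ.+[1+ d ]) ⟩
  mkℚᵘ (+ 1) d ℚᵘ.+ mkℚᵘ (+ 1) d           ≈⟨ ℚᵘ.+-cong (toℚᵘ-fromℚᵘ (mkℚᵘ (+ 1) d))
                                                          (toℚᵘ-fromℚᵘ (mkℚᵘ (+ 1) d)) ⟨
  toℚᵘ (+ 1 / suc d) ℚᵘ.+ toℚᵘ (+ 1 / suc d) ≈⟨ toℚᵘ-homo-+ (+ 1 / suc d) (+ 1 / suc d) ⟨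
  toℚᵘ (+ 1 / suc d + + 1 / suc d)         ∎)
  where
  open ℚᵘ.≃-Reasoning
  cross-multiplied : ∀ m → + 2 ℤ.* (m ℤ.* m) ≡ (+ 1 ℤ.* m ℤ.+ + 1 ℤ.* m) ℤ.* m
  cross-multiplied = ℤ-Solver.solve-∀

0≤1-2/k : ∀ k .{{_ : NonZero k}} → 2 ≤ℕ k → 0ℚ ≤ 1ℚ - + 2 / k
0≤1-2/k (suc zero)    (s≤s ())
0≤1-2/k (suc (suc e)) _ = p≤q⇒0≤q-p {+ 2 / suc (suc e)} {1ℚ} (toℚᵘ-cancel-≤
  (ℚᵘ.≤-respˡ-≃ (ℚᵘ.≃-sym (toℚᵘ-fromℚᵘ (mkℚᵘ (+ 2) (suc e)))) (*≤* (ℤ.+≤+ (s≤s (s≤s z≤n))))))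

affine-step : ∀ {ρ c} → ρ ≡ 1ℚ - (c + c) → ∀ {p q} → p + q ≡ 1ℚ → p + c * q - c * p ≡ ρ * p + c
affine-step {c = c} refl {p} {q} p+q≡1 = begin
  p + c * q - c * p              ≡⟨ cong (λ t → p + c * t - c * p) q≡1-p ⟩
  p + c * (1ℚ - p) - c * p       ≡⟨ expand c p ⟩
  (1ℚ - (c + c)) * p + c         ∎
  where
  open ≡-Reasoning
  q≡1-p : q ≡ 1ℚ - p
  q≡1-p = trans (cancel p q) (cong (_- p) p+q≡1)
    where
    cancel : ∀ p q → q ≡ p + q - p
    cancel = solve-∀ ℚ-ring
  expand : ∀ c p → p + c * (1ℚ - p) - c * p ≡ (1ℚ - (c + c)) * p + c
  expand = solve-∀ ℚ-ring

½-affine : ∀ {ρ c} → ρ ≡ 1ℚ - (c + c) → ∀ t → ½ * (1ℚ + ρ * t) ≡ ρ * (½ * (1ℚ + t)) + c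
½-affine {c = c} refl t = begin
  ½ * (1ℚ + (1ℚ - (c + c)) * t)
    ≡⟨ expand ½ c t ⟩
  (1ℚ - (c + c)) * (½ * (1ℚ + t)) + c + c * (½ + ½ - 1ℚ)
    ≡⟨ cong (_+_ ((1ℚ - (c + c)) * (½ * (1ℚ + t)) + c)) (*-zeroʳ c) ⟩
  (1ℚ - (c + c)) * (½ * (1ℚ + t)) + c + 0ℚ
    ≡⟨ +-identityʳ _ ⟩
  (1ℚ - (c + c)) * (½ * (1ℚ + t)) + c ∎
  where
  open ≡-Reasoning
  expand : ∀ h c t → h * (1ℚ + (1ℚ - (c + c)) * t)
                       ≡ (1ℚ - (c + c)) * (h * (1ℚ + t)) + c + c * (h + h - 1ℚ)
  expand = solve-∀ ℚ-ring

-- The comparison with ½(1 + ρⁱ) needs ρ ≥ 0 only from the second step on,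
-- where the two sides may differ; this covers ρ = -1 for m = 1.
affine-recurrence-lower-bound :
  ∀ {ρ c} → ρ ≡ 1ℚ - (c + c) → ∀ m → (2 ≤ℕ m → 0ℚ ≤ ρ) →
  (p : ℕ → ℚ) → p 0 ≡ 1ℚ → (∀ i → suc i ≤ℕ m → ρ * p i + c ≤ p (suc i)) →
  ∀ i → i ≤ℕ m → ½ * (1ℚ + ρ ^ℚ i) ≤ p i
affine-recurrence-lower-bound {ρ} {c} ρ≡ m 0≤ρ p p0≡1 p-step = bound
  where
  open ≤-Reasoning
  bound : ∀ i → i ≤ℕ m → ½ * (1ℚ + ρ ^ℚ i) ≤ p i
  scaled : ∀ i → suc i ≤ℕ m → ρ * (½ * (1ℚ + ρ ^ℚ i)) ≤ ρ * p i
  scaled zero    _       = ≤-reflexive (cong (ρ *_) (sym p0≡1))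
  scaled (suc i) 2+i≤m = *-monoˡ-≤-0≤ (0≤ρ (ℕ.≤-trans (s≤s (s≤s z≤n)) 2+i≤m))
                                      (bound (suc i) (ℕ.<⇒≤ 2+i≤m))
  bound zero    _     = ≤-reflexive (sym p0≡1)
  bound (suc i) 1+i≤m = begin
    ½ * (1ℚ + ρ * ρ ^ℚ i)         ≡⟨ ½-affine ρ≡ (ρ ^ℚ i) ⟩
    ρ * (½ * (1ℚ + ρ ^ℚ i)) + c    ≤⟨ +-monoˡ-≤ c (scaled i 1+i≤m) ⟩
    ρ * p i + c                    ≤⟨ p-step i 1+i≤m ⟩
    p (suc i)                      ∎

module _ {n : ℕ} (k : ℕ) {{_ : NonZero k}} (D : Subset n)
         (f₀ : Subset n → ℚ) (I₀ : Subset n → Set) (r : DRG.Run k D f₀ I₀) where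

  open DRG k D f₀ I₀ using (1/k)
  open DRG.Run r

  run-weights : ∀ i → i ≤ℕ k → NonNegWeights (𝒟 i) × mass (𝒟 i) ≡ 1ℚ
  run-weights zero    _   = (≤ᵇ⇒≤ tt ∷ []) , 𝔼≡𝔼ₘ (𝒟 0) (λ _ → 1ℚ)
  run-weights (suc i) i<k with run-weights i (ℕ.<⇒≤ i<k)
  ... | nonNeg , mass≡1 = S.step-nonNeg , trans S.mass-step mass≡1
    where
    module S = Step k D f₀ I₀ (𝒟 i) (M (suc i)) (g (suc i)) (x (suc i)) nonNeg (proj₁ (x-ext i i<k))

  PrNotIn-initial : ∀ u → u ∉ D → PrNotIn (𝒟 0) u ≡ 1ℚ
  PrNotIn-initial u u∉D = trans (𝔼≡𝔼ₘ (𝒟 0) (λ S → 𝟙 (¬? (u ∈? S)))) (absent (u ∈? S₀))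
    where
    absent : (d : Dec (u ∈ S₀)) → 1ℚ * 𝟙 (¬? d) + 0ℚ ≡ 1ℚ
    absent (yes u∈S₀) = ⊥-elim (u∉D (S₀-dummy u∈S₀))
    absent (no _)     = refl

  PrNotIn-recurrence : ∀ u i → suc i ≤ℕ k →
                       (1ℚ - + 2 / k) * PrNotIn (𝒟 i) u + 1/k ≤ PrNotIn (𝒟 (suc i)) u
  PrNotIn-recurrence u i i<k with run-weights i (ℕ.<⇒≤ i<k)
  ... | nonNeg , mass≡1 = ≤-trans
    (≤-reflexive (sym (affine-step (cong (_-_ 1ℚ) (2/k≡1/k+1/k k))
                                    (trans (PrNotIn+PrIn≡mass (𝒟 i) u) mass≡1))))
    (S.PrNotIn-step u)
    where
    module S = Step k D f₀ I₀ (𝒟 i) (M (suc i)) (g (suc i)) (x (suc i)) nonNeg (proj₁ (x-ext i i<k))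

lemma4 : {n : ℕ} (k : ℕ) {{_ : NonZero k}} (D : Subset n)
         (f₀ : Subset n → ℚ) (I₀ : Subset n → Set) →
         OriginalInstance k D f₀ I₀ →
         (r : DRG.Run k D f₀ I₀) →
         ∀ (u : Fin n) → u ∉ D → ∀ (i : ℕ) → i ≤ℕ k →
         ½ * (1ℚ + (1ℚ - + 2 / k) ^ℚ i) ≤ PrNotIn (DRG.Run.𝒟 r i) u
lemma4 k D f₀ I₀ _ r u u∉D =
  affine-recurrence-lower-bound (cong (_-_ 1ℚ) (2/k≡1/k+1/k k)) k (0≤1-2/k k)
    (λ i → PrNotIn (DRG.Run.𝒟 r i) u)
    (PrNotIn-initial k D f₀ I₀ r u u∉D)
    (PrNotIn-recurrence k D f₀ I₀ r u)
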